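{- Let $i \geq 3$ be an integer, let $D$ be an $(i,2)$ digraph, let $H$ be a hole of length $l\geq 5$ in $U(D)$, and let $C$ be the cycle in $P(D)$ obtained from $H$ by $\Gamma_H$. Then every clique of the subgraph of $P(D)$ induced by $V(C)$ has size at most $i$.
   Context: An $(i,j)$ digraph is an acyclic digraph in which every vertex has indegree at most $i$ and outdegree at most $j$. $U(D)$ is the underlying graph of $D$ (edge $uv$ iff $(u,v)$ or $(v,u)$ is an arc). The phylogeny graph $P(D)$ has vertex set $V(D)$ and an edge between distinct $u,v$ iff $(u,v)\in A(D)$ or $(v,u)\in A(D)$ or $u,v$ have a common out-neighbor. A hole is an induced cycle of length at least $4$. For a hole $H=v_1\cdots v_lv_1$ of $U(D)$ with $l\ge 5$, $\Gamma_H$ is the set of vertices of $H$ with exactly two in-neighbors in the subdigraph $D_H$ of $D$ induced by $V(H)$ (no two consecutive on $H$), and the cycle obtained from $H$ by $\Gamma_H$ is the cycle in $P(D)$ on $V(H)-\Gamma_H$ in the cyclic order of $H$ (each path $v_{a-1}v_av_{a+1}$ with $v_a\in\Gamma_H$ replaced by the edge $v_{a-1}v_{a+1}$). -}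

module Defs where

open import Data.Nat using (ℕ; zero; suc; _+_; _≤_)
open import Data.Fin using (Fin; toℕ)
open import Data.Fin.Base using ()
open import Data.Bool using (Bool; true; false; if_then_else_)
open import Data.List using (List; map; allFin)
open import Data.Nat.ListAction using (sum)
open import Data.Product using (Σ; _×_; ∃; ∃-syntax)
open import Data.Sum using (_⊎_)
open import Relation.Nullary using (¬_)
open import Relation.Binary.PropositionalEquality using (_≡_; _≢_)
open import Relation.Binary.Construct.Closure.Transitive using (TransClosure)
open import Function.Bundles using (_⇔_)
open import Function.Definitions using (Injective)

Digraph : ℕ → Set
Digraph n = Fin n → Fin n → Bool

Arc : ∀ {n} → Digraph n → Fin n → Fin n → Set
Arc D u v = D u v ≡ true

countFin : (m : ℕ) → (Fin m → Bool) → ℕ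
countFin m p = sum (map (λ x → if p x then 1 else 0) (allFin m))

indeg : ∀ {n} → Digraph n → Fin n → ℕ
indeg {n} D v = countFin n (λ u → D u v)

outdeg : ∀ {n} → Digraph n → Fin n → ℕ
outdeg {n} D u = countFin n (λ v → D u v)

Acyclic : ∀ {n} → Digraph n → Set
Acyclic D = ∀ v → ¬ TransClosure (Arc D) v v

IsIJDigraph : ∀ {n} → ℕ → ℕ → Digraph n → Set
IsIJDigraph i j D = Acyclic D × (∀ v → indeg D v ≤ i) × (∀ v → outdeg D v ≤ j)

UAdj : ∀ {n} → Digraph n → Fin n → Fin n → Set
UAdj D u v = Arc D u v ⊎ Arc D v u

PAdj : ∀ {n} → Digraph n → Fin n → Fin n → Set
PAdj D u v = u ≢ v × (Arc D u v ⊎ Arc D v u ⊎ ∃[ w ] (Arc D u w × Arc D v w))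

CycConsec : (l : ℕ) → Fin l → Fin l → Set
CycConsec l a b =
  toℕ b ≡ suc (toℕ a) ⊎ toℕ a ≡ suc (toℕ b)
  ⊎ (toℕ a ≡ 0 × suc (toℕ b) ≡ l) ⊎ (toℕ b ≡ 0 × suc (toℕ a) ≡ l)

-- h : Fin l → Fin n lists the vertices v_0 ... v_{l-1} of a hole H = v_0 v_1 ... v_{l-1} v_0
-- of U(D): distinct vertices, l ≥ 4, and two distinct ones are adjacent in U(D)
-- iff they are consecutive on the cycle (i.e. an induced cycle).
IsHole : ∀ {n} → Digraph n → (l : ℕ) → (Fin l → Fin n) → Set
IsHole D l h =
  4 ≤ l × Injective _≡_ _≡_ h
  × (∀ a b → a ≢ b → (UAdj D (h a) (h b) ⇔ CycConsec l a b))

indegH : ∀ {n} → Digraph n → (l : ℕ) → (Fin l → Fin n) → Fin l → ℕ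
indegH D l h a = countFin l (λ b → D (h b) (h a))

InGamma : ∀ {n} → Digraph n → (l : ℕ) → (Fin l → Fin n) → Fin l → Set
InGamma D l h a = indegH D l h a ≡ 2

-- x ∈ V(C) = V(H) − Γ_H, where C is the cycle obtained from H by Γ_H
InVC : ∀ {n} → Digraph n → (l : ℕ) → (Fin l → Fin n) → Fin n → Set
InVC D l h x = ∃[ a ] (h a ≡ x × ¬ InGamma D l h a)

{-# OPTIONS --safe #-}
module Submission where

-- A vertex of C is not in Γ_H and, H being induced, has at most two in-neighbours in D_H; so it
-- has at most one in-neighbour on H, hence an out-neighbour on H, hence (outdegree ≤ 2) at most one
-- out-neighbour off H. Call two vertices of a clique K ⊆ V(C) adjacent via the hole if they are
-- joined by an arc or have a common out-neighbour on H; every other pair of K has a common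
-- out-neighbour off H. Acyclicity and the degree bounds show that no vertex of K is adjacent via
-- the hole to three others, and that no four vertices of K having out-neighbours off H form a
-- 4-cycle of such adjacencies. A short case analysis then shows that any four vertices of K, and
-- hence all of K once |K| ≥ 4, share an out-neighbour w off H, so |K| ≤ indeg w ≤ i.


open import Defs
open import Data.Nat using (ℕ; suc; _≤_; z≤n; s≤s; _<?_)
open import Data.Nat.Properties
  using (≤-trans; ≤-antisym; <⇒≤; <⇒≢; ≮⇒≥; suc-injective; 0≢1+n; 1+n≢n; m≢1+n+m)
open import Data.Fin using (Fin; toℕ; fromℕ; fromℕ<; inject₁) renaming (zero to fzero; suc to fsuc)
open import Data.Fin.Properties using (_≟_; any?; toℕ-injective; toℕ<n; toℕ-fromℕ; toℕ-fromℕ<; toℕ-inject₁)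
open import Data.Bool using (Bool; true; false; if_then_else_) renaming (_≟_ to _≟ᵇ_)
open import Data.List using (List; []; _∷_; length; map; filter; allFin)
open import Data.List.Properties using (length-removeAt′)
open import Data.Nat.ListAction using (sum)
open import Data.List.Relation.Unary.All as All using (All; []; _∷_)
open import Data.List.Relation.Unary.All.Properties using (all-filter)
open import Data.List.Relation.Unary.Any using (here; there; _─_)
open import Data.List.Relation.Unary.AllPairs using ([]; _∷_)
open import Data.List.Relation.Unary.Unique.Propositional using (Unique)
open import Data.List.Relation.Unary.Unique.Propositional.Properties using (allFin⁺; filter⁺)
open import Data.List.Membership.Propositional using (_∈_)
open import Data.List.Membership.Propositional.Properties using (∈-allFin; ∈-filter⁺)
open import Data.Product using (_×_; _,_; ∃; ∃₂; proj₁; proj₂)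
open import Function using (_∘_)
open import Function.Bundles using (Equivalence)
open import Data.Sum using (_⊎_; inj₁; inj₂)
open import Data.Empty using (⊥; ⊥-elim)
open import Relation.Nullary using (¬_; Dec; yes; no)
open import Relation.Binary.Definitions using (DecidableEquality)
open import Relation.Binary.Construct.Closure.Transitive using ([_]; _∷_)
open import Relation.Binary.PropositionalEquality
  using (_≡_; _≢_; refl; sym; trans; cong; subst; ≢-sym)

∈-─⁺ : ∀ {A : Set} {x y : A} {ys} (x∈ys : x ∈ ys) → x ≢ y → y ∈ ys → y ∈ (ys ─ x∈ys)
∈-─⁺ (here refl) x≢y (here refl) with () ← x≢y refl
∈-─⁺ (here refl) _   (there y∈ys) = y∈ys
∈-─⁺ (there _)   _   (here refl) = here refl
∈-─⁺ (there x∈ys) x≢y (there y∈ys) = there (∈-─⁺ x∈ys x≢y y∈ys)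

unique⊆⇒length≤ : ∀ {A : Set} {xs ys : List A} → Unique xs → All (_∈ ys) xs → length xs ≤ length ys
unique⊆⇒length≤ [] [] = z≤n
unique⊆⇒length≤ {ys = ys} (x∉xs ∷ xs!) (x∈ys ∷ xs⊆ys) =
  subst (suc _ ≤_) (sym (length-removeAt′ ys _))
    (s≤s (unique⊆⇒length≤ xs! (All.zipWith (λ (x≢y , y∈ys) → ∈-─⁺ x∈ys x≢y y∈ys) (x∉xs , xs⊆ys))))

module _ {A : Set} (p : A → Bool) where

  sum-indicator≡length-filter : ∀ xs →
    sum (map (λ x → if p x then 1 else 0) xs) ≡ length (filter (λ x → p x ≟ᵇ true) xs)
  sum-indicator≡length-filter [] = refl
  sum-indicator≡length-filter (x ∷ xs) with p x
  ... | true  = cong suc (sum-indicator≡length-filter xs)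
  ... | false = sum-indicator≡length-filter xs

module _ {m : ℕ} {p : Fin m → Bool} where

  private
    P? = λ x → p x ≟ᵇ true

  length≤countFin : ∀ {xs} → Unique xs → All (λ x → p x ≡ true) xs → length xs ≤ countFin m p
  length≤countFin xs! pxs =
    subst (_ ≤_) (sym (sum-indicator≡length-filter p (allFin m)))
      (unique⊆⇒length≤ xs! (All.map (λ {x} px → ∈-filter⁺ P? (∈-allFin x) px) pxs))

  countFin≤ : ∀ {k} → (∀ {xs} → Unique xs → All (λ x → p x ≡ true) xs → length xs ≤ k) → countFin m p ≤ k
  countFin≤ bound =
    subst (_≤ _) (sym (sum-indicator≡length-filter p (allFin m)))
      (bound (filter⁺ P? (allFin⁺ m)) (all-filter P? (allFin m)))

CycSucc : (l : ℕ) → Fin l → Fin l → Set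
CycSucc l a b = toℕ b ≡ suc (toℕ a) ⊎ (toℕ b ≡ 0 × suc (toℕ a) ≡ l)

module _ {l : ℕ} where

  CycSucc-functional : ∀ {a b c : Fin l} → CycSucc l a b → CycSucc l a c → b ≡ c
  CycSucc-functional (inj₁ b≡) (inj₁ c≡) = toℕ-injective (trans b≡ (sym c≡))
  CycSucc-functional {b = b} (inj₁ b≡) (inj₂ (_ , a≡)) = ⊥-elim (<⇒≢ (toℕ<n b) (trans b≡ a≡))
  CycSucc-functional {c = c} (inj₂ (_ , a≡)) (inj₁ c≡) = ⊥-elim (<⇒≢ (toℕ<n c) (trans c≡ a≡))
  CycSucc-functional (inj₂ (b≡0 , _)) (inj₂ (c≡0 , _)) = toℕ-injective (trans b≡0 (sym c≡0))

  CycSucc-injective : ∀ {a b c : Fin l} → CycSucc l a c → CycSucc l b c → a ≡ b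
  CycSucc-injective (inj₁ a≡) (inj₁ b≡) = toℕ-injective (suc-injective (trans (sym a≡) b≡))
  CycSucc-injective (inj₁ c≡) (inj₂ (c≡0 , _)) = ⊥-elim (0≢1+n (trans (sym c≡0) c≡))
  CycSucc-injective (inj₂ (c≡0 , _)) (inj₁ c≡) = ⊥-elim (0≢1+n (trans (sym c≡0) c≡))
  CycSucc-injective (inj₂ (_ , a≡)) (inj₂ (_ , b≡)) = toℕ-injective (suc-injective (trans a≡ (sym b≡)))

  CycSucc-irrefl : 2 ≤ l → ∀ {a : Fin l} → ¬ CycSucc l a a
  CycSucc-irrefl _ (inj₁ a≡) = 1+n≢n (sym a≡)
  CycSucc-irrefl 2≤l (inj₂ (a≡0 , a+1≡l))
    with s≤s () ← subst (2 ≤_) (trans (sym a+1≡l) (cong suc a≡0)) 2≤l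

  CycSucc-asym : 3 ≤ l → ∀ {a b : Fin l} → CycSucc l a b → ¬ CycSucc l b a
  CycSucc-asym _ (inj₁ b≡) (inj₁ a≡) = m≢1+n+m _ {1} (trans a≡ (cong suc b≡))
  CycSucc-asym 3≤l (inj₁ b≡) (inj₂ (a≡0 , b+1≡l))
    with s≤s (s≤s ()) ← subst (3 ≤_) (trans (sym b+1≡l) (cong suc (trans b≡ (cong suc a≡0)))) 3≤l
  CycSucc-asym 3≤l (inj₂ (b≡0 , a+1≡l)) (inj₁ a≡)
    with s≤s (s≤s ()) ← subst (3 ≤_) (trans (sym a+1≡l) (cong suc (trans a≡ (cong suc b≡0)))) 3≤l
  CycSucc-asym 3≤l (inj₂ (b≡0 , _)) (inj₂ (_ , b+1≡l))
    with s≤s () ← subst (3 ≤_) (trans (sym b+1≡l) (cong suc b≡0)) 3≤l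

cycSucc : ∀ {l} (a : Fin l) → ∃ (CycSucc l a)
cycSucc {l = suc k} a with suc (toℕ a) <? suc k
... | yes a+1<l = fromℕ< a+1<l , inj₁ (toℕ-fromℕ< a+1<l)
... | no  a+1≮l = fzero , inj₂ (refl , ≤-antisym (toℕ<n a) (≮⇒≥ a+1≮l))

cycPred : ∀ {l} (a : Fin l) → ∃ λ b → CycSucc l b a
cycPred {l = suc k} fzero = fromℕ k , inj₂ (refl , cong suc (toℕ-fromℕ k))
cycPred (fsuc a) = inject₁ a , inj₁ (cong suc (sym (toℕ-inject₁ a)))

module _ {l : ℕ} {a b : Fin l} where

  CycConsec⇒CycSucc : CycConsec l a b → CycSucc l a b ⊎ CycSucc l b a
  CycConsec⇒CycSucc (inj₁ b≡) = inj₁ (inj₁ b≡)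
  CycConsec⇒CycSucc (inj₂ (inj₁ a≡)) = inj₂ (inj₁ a≡)
  CycConsec⇒CycSucc (inj₂ (inj₂ (inj₁ (a≡0 , b+1≡l)))) = inj₂ (inj₂ (a≡0 , b+1≡l))
  CycConsec⇒CycSucc (inj₂ (inj₂ (inj₂ (b≡0 , a+1≡l)))) = inj₁ (inj₂ (b≡0 , a+1≡l))

  CycSucc⇒CycConsec : CycSucc l a b ⊎ CycSucc l b a → CycConsec l a b
  CycSucc⇒CycConsec (inj₁ (inj₁ b≡)) = inj₁ b≡
  CycSucc⇒CycConsec (inj₁ (inj₂ b≡0,a+1≡l)) = inj₂ (inj₂ (inj₂ b≡0,a+1≡l))
  CycSucc⇒CycConsec (inj₂ (inj₁ a≡)) = inj₂ (inj₁ a≡)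
  CycSucc⇒CycConsec (inj₂ (inj₂ a≡0,b+1≡l)) = inj₂ (inj₂ (inj₁ a≡0,b+1≡l))

CycConsec-at-most-two : ∀ {l} {a b₁ b₂ b₃ : Fin l} → b₁ ≢ b₂ → b₁ ≢ b₃ → b₂ ≢ b₃ →
  CycConsec l a b₁ → CycConsec l a b₂ → CycConsec l a b₃ → ⊥
CycConsec-at-most-two b₁≢b₂ b₁≢b₃ b₂≢b₃ c₁ c₂ c₃
  with CycConsec⇒CycSucc c₁ | CycConsec⇒CycSucc c₂ | CycConsec⇒CycSucc c₃
... | inj₁ s₁ | inj₁ s₂ | _      = b₁≢b₂ (CycSucc-functional s₁ s₂)
... | inj₂ p₁ | inj₂ p₂ | _      = b₁≢b₂ (CycSucc-injective p₁ p₂)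
... | inj₁ s₁ | inj₂ _  | inj₁ s₃ = b₁≢b₃ (CycSucc-functional s₁ s₃)
... | inj₂ p₁ | inj₁ _  | inj₂ p₃ = b₁≢b₃ (CycSucc-injective p₁ p₃)
... | inj₁ _  | inj₂ p₂ | inj₂ p₃ = b₂≢b₃ (CycSucc-injective p₂ p₃)
... | inj₂ _  | inj₁ s₂ | inj₁ s₃ = b₂≢b₃ (CycSucc-functional s₂ s₃)

two-CycConsec : ∀ {l} → 3 ≤ l → (a : Fin l) →
  ∃₂ λ b c → a ≢ b × a ≢ c × b ≢ c × CycConsec l a b × CycConsec l a c
two-CycConsec 3≤l a with cycSucc a | cycPred a
... | b , a→b | c , c→a =
  b , c , a≢b , a≢c , b≢c , CycSucc⇒CycConsec (inj₁ a→b) , CycSucc⇒CycConsec (inj₂ c→a)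
  where
  a≢b : a ≢ b
  a≢b refl = CycSucc-irrefl (<⇒≤ 3≤l) a→b
  a≢c : a ≢ c
  a≢c refl = CycSucc-irrefl (<⇒≤ 3≤l) c→a
  b≢c : b ≢ c
  b≢c refl = CycSucc-asym 3≤l a→b c→a

module CommonTarget {A : Set} (_≟_ : DecidableEquality A) (S : A → Set) (Near Out : A → A → Set) where

  Common : A → A → Set
  Common x y = ∃ λ w → Out x w × Out y w

  module _
    (near-sym : ∀ {x y} → Near x y → Near y x)
    (target-unique : ∀ {x w w′} → S x → Out x w → Out x w′ → w ≡ w′)
    (near-or-common : ∀ {x y} → S x → S y → x ≢ y → Near x y ⊎ Common x y)
    (no-three-near : ∀ {x y₁ y₂ y₃} → S x → S y₁ → S y₂ → S y₃ →
      x ≢ y₁ → x ≢ y₂ → x ≢ y₃ → y₁ ≢ y₂ → y₁ ≢ y₃ → y₂ ≢ y₃ →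
      Near x y₁ → Near x y₂ → Near x y₃ → ⊥)
    (no-near-square : ∀ {a b c d} → S a → S b → S c → S d →
      a ≢ b → a ≢ c → a ≢ d → b ≢ c → b ≢ d → c ≢ d →
      ∃ (Out a) → ∃ (Out b) → ∃ (Out c) → ∃ (Out d) →
      Near a b → Near b c → Near c d → Near d a → ⊥)
    where

    Common⇒same-target : ∀ {a x w} → S a → Out a w → Common a x → Out x w
    Common⇒same-target sa aw (w′ , aw′ , xw′) = subst (Out _) (target-unique sa aw′ aw) xw′

    target⊎near-both : ∀ {a b x w} → S a → S b → S x → a ≢ x → b ≢ x →
      Out a w → Out b w → Out x w ⊎ (Near a x × Near b x)
    target⊎near-both sa sb sx a≢x b≢x aw bw with near-or-common sa sx a≢x
    ... | inj₂ a≈x = inj₁ (Common⇒same-target sa aw a≈x)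
    ... | inj₁ a~x with near-or-common sb sx b≢x
    ...   | inj₂ b≈x = inj₁ (Common⇒same-target sb bw b≈x)
    ...   | inj₁ b~x = inj₂ (a~x , b~x)

    near-both⇒target : ∀ {a b c d w} → S a → S b → S c → S d →
      a ≢ b → a ≢ d → b ≢ d → c ≢ a → c ≢ b → c ≢ d →
      Out d w → Near c a → Near c b → Out c w
    near-both⇒target sa sb sc sd a≢b a≢d b≢d c≢a c≢b c≢d dw c~a c~b with near-or-common sd sc (≢-sym c≢d)
    ... | inj₂ d≈c = Common⇒same-target sd dw d≈c
    ... | inj₁ d~c = ⊥-elim (no-three-near sc sa sb sd c≢a c≢b c≢d a≢b a≢d b≢d c~a c~b (near-sym d~c))

    common-target-extends : ∀ {a b c d w} → S a → S b → S c → S d →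
      a ≢ b → a ≢ c → a ≢ d → b ≢ c → b ≢ d → c ≢ d →
      Out a w → Out b w → Out c w × Out d w
    common-target-extends sa sb sc sd a≢b a≢c a≢d b≢c b≢d c≢d aw bw
      with target⊎near-both sa sb sc a≢c b≢c aw bw | target⊎near-both sa sb sd a≢d b≢d aw bw
    ... | inj₁ cw | inj₁ dw = cw , dw
    ... | inj₂ (a~c , b~c) | inj₁ dw =
      near-both⇒target sa sb sc sd a≢b a≢d b≢d (≢-sym a≢c) (≢-sym b≢c) c≢d dw (near-sym a~c) (near-sym b~c) , dw
    ... | inj₁ cw | inj₂ (a~d , b~d) =
      cw , near-both⇒target sa sb sd sc a≢b a≢c b≢c (≢-sym a≢d) (≢-sym b≢d) (≢-sym c≢d) cw (near-sym a~d) (near-sym b~d)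
    ... | inj₂ (a~c , b~c) | inj₂ (a~d , b~d) with near-or-common sc sd c≢d
    ...   | inj₁ c~d = ⊥-elim (no-three-near sc sa sb sd (≢-sym a≢c) (≢-sym b≢c) c≢d a≢b a≢d b≢d
                                (near-sym a~c) (near-sym b~c) c~d)
    ...   | inj₂ (w′ , cw′ , dw′) = ⊥-elim (no-near-square sa sc sb sd a≢c a≢b a≢d (≢-sym b≢c) c≢d b≢d
                                (_ , aw) (_ , cw′) (_ , bw) (_ , dw′) a~c (near-sym b~c) b~d (near-sym a~d))

    common-target-of-four : ∀ {a b c d} → S a → S b → S c → S d →
      a ≢ b → a ≢ c → a ≢ d → b ≢ c → b ≢ d → c ≢ d →
      ∃ λ w → Out a w × Out b w × Out c w × Out d w
    common-target-of-four sa sb sc sd a≢b a≢c a≢d b≢c b≢d c≢d with near-or-common sa sb a≢b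
    ... | inj₂ (w , aw , bw) = w , aw , bw , common-target-extends sa sb sc sd a≢b a≢c a≢d b≢c b≢d c≢d aw bw
    ... | inj₁ a~b with near-or-common sa sc a≢c
    ...   | inj₂ (w , aw , cw) with common-target-extends sa sc sb sd a≢c a≢b a≢d (≢-sym b≢c) c≢d b≢d aw cw
    ...     | bw , dw = w , aw , bw , cw , dw
    common-target-of-four sa sb sc sd a≢b a≢c a≢d b≢c b≢d c≢d | inj₁ a~b | inj₁ a~c
      with near-or-common sa sd a≢d
    ... | inj₂ (w , aw , dw) with common-target-extends sa sd sb sc a≢d a≢b a≢c (≢-sym b≢d) (≢-sym c≢d) b≢c aw dw
    ...   | bw , cw = w , aw , bw , cw , dw
    common-target-of-four sa sb sc sd a≢b a≢c a≢d b≢c b≢d c≢d | inj₁ a~b | inj₁ a~c | inj₁ a~d =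
      ⊥-elim (no-three-near sa sb sc sd a≢b a≢c a≢d b≢c b≢d c≢d a~b a~c a~d)

    common-target : ∀ {a b c d} → S a → S b → S c → S d →
      a ≢ b → a ≢ c → a ≢ d → b ≢ c → b ≢ d → c ≢ d →
      ∃ λ w → ∀ {x} → S x → Out x w
    common-target {a} {b} {c} sa sb sc sd a≢b a≢c a≢d b≢c b≢d c≢d
      with common-target-of-four sa sb sc sd a≢b a≢c a≢d b≢c b≢d c≢d
    ... | w , aw , bw , cw , _ = w , target
      where
      target : ∀ {x} → S x → Out x w
      target {x} sx with x ≟ a | x ≟ b | x ≟ c
      ... | yes refl | _        | _        = aw
      ... | no _     | yes refl | _        = bw
      ... | no _     | no _     | yes refl = cw
      ... | no x≢a   | no x≢b   | no x≢c
        with common-target-of-four sa sb sc sx a≢b a≢c (≢-sym x≢a) b≢c (≢-sym x≢b) (≢-sym x≢c)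
      ...   | _ , aw′ , _ , _ , xw′ = subst (Out x) (target-unique sa aw′ aw) xw′

    small-or-common-target : ∀ {K} → Unique K → All S K → length K ≤ 3 ⊎ ∃ λ w → All (λ x → Out x w) K
    small-or-common-target {[]} _ _ = inj₁ z≤n
    small-or-common-target {_ ∷ []} _ _ = inj₁ (s≤s z≤n)
    small-or-common-target {_ ∷ _ ∷ []} _ _ = inj₁ (s≤s (s≤s z≤n))
    small-or-common-target {_ ∷ _ ∷ _ ∷ []} _ _ = inj₁ (s≤s (s≤s (s≤s z≤n)))
    small-or-common-target {_ ∷ _ ∷ _ ∷ _ ∷ _}
      ((a≢b ∷ a≢c ∷ a≢d ∷ _) ∷ (b≢c ∷ b≢d ∷ _) ∷ (c≢d ∷ _) ∷ _) sK@(sa ∷ sb ∷ sc ∷ sd ∷ _)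
      with common-target sa sb sc sd a≢b a≢c a≢d b≢c b≢d c≢d
    ... | w , target = inj₂ (w , All.map target sK)

module _ {n : ℕ} {D : Digraph n} (acyclic : Acyclic D) where

  arc⇒≢ : ∀ {x y} → Arc D x y → x ≢ y
  arc⇒≢ {x} x→x refl = acyclic x [ x→x ]

  no-2-cycle : ∀ {x y} → Arc D x y → ¬ Arc D y x
  no-2-cycle {x} x→y y→x = acyclic x (x→y ∷ [ y→x ])

  no-4-cycle : ∀ {a b c d} → Arc D a b → Arc D b c → Arc D c d → ¬ Arc D d a
  no-4-cycle {a} a→b b→c c→d d→a = acyclic a (a→b ∷ b→c ∷ c→d ∷ [ d→a ])

module _ {n : ℕ} {D : Digraph n} (outdeg≤2 : ∀ v → outdeg D v ≤ 2) where

  no-three-out-neighbours : ∀ {x y₁ y₂ y₃} → y₁ ≢ y₂ → y₁ ≢ y₃ → y₂ ≢ y₃ →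
    Arc D x y₁ → Arc D x y₂ → Arc D x y₃ → ⊥
  no-three-out-neighbours {x} y₁≢y₂ y₁≢y₃ y₂≢y₃ x→y₁ x→y₂ x→y₃
    with s≤s (s≤s ()) ← ≤-trans
      (length≤countFin ((y₁≢y₂ ∷ y₁≢y₃ ∷ []) ∷ (y₂≢y₃ ∷ []) ∷ [] ∷ []) (x→y₁ ∷ x→y₂ ∷ x→y₃ ∷ []))
      (outdeg≤2 x)

module Hole {n : ℕ} {D : Digraph n} (acyclic : Acyclic D) (outdeg≤2 : ∀ v → outdeg D v ≤ 2)
            {l : ℕ} {h : Fin l → Fin n} (hole : IsHole D l h) where

  3≤l : 3 ≤ l
  3≤l = <⇒≤ (proj₁ hole)

  h-≢ : ∀ {a b} → a ≢ b → h a ≢ h b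
  h-≢ a≢b = a≢b ∘ proj₁ (proj₂ hole)

  consecutive⇒adjacent : ∀ {a b} → a ≢ b → CycConsec l a b → UAdj D (h a) (h b)
  consecutive⇒adjacent a≢b = Equivalence.from (proj₂ (proj₂ hole) _ _ a≢b)

  adjacent⇒consecutive : ∀ {a b} → a ≢ b → UAdj D (h a) (h b) → CycConsec l a b
  adjacent⇒consecutive a≢b = Equivalence.to (proj₂ (proj₂ hole) _ _ a≢b)

  OnHole : Fin n → Set
  OnHole x = ∃ λ a → h a ≡ x

  on-hole? : ∀ x → Dec (OnHole x)
  on-hole? x = any? (λ a → h a ≟ x)

  no-three-hole-neighbours : ∀ {x y₁ y₂ y₃} → OnHole x → OnHole y₁ → OnHole y₂ → OnHole y₃ →
    x ≢ y₁ → x ≢ y₂ → x ≢ y₃ → y₁ ≢ y₂ → y₁ ≢ y₃ → y₂ ≢ y₃ →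
    UAdj D x y₁ → UAdj D x y₂ → UAdj D x y₃ → ⊥
  no-three-hole-neighbours (a , refl) (b₁ , refl) (b₂ , refl) (b₃ , refl)
    x≢y₁ x≢y₂ x≢y₃ y₁≢y₂ y₁≢y₃ y₂≢y₃ x~y₁ x~y₂ x~y₃ =
    CycConsec-at-most-two (y₁≢y₂ ∘ cong h) (y₁≢y₃ ∘ cong h) (y₂≢y₃ ∘ cong h)
      (adjacent⇒consecutive (x≢y₁ ∘ cong h) x~y₁)
      (adjacent⇒consecutive (x≢y₂ ∘ cong h) x~y₂)
      (adjacent⇒consecutive (x≢y₃ ∘ cong h) x~y₃)

  no-three-hole-in-neighbours : ∀ {x y₁ y₂ y₃} → OnHole x → OnHole y₁ → OnHole y₂ → OnHole y₃ →
    y₁ ≢ y₂ → y₁ ≢ y₃ → y₂ ≢ y₃ → Arc D y₁ x → Arc D y₂ x → Arc D y₃ x → ⊥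
  no-three-hole-in-neighbours x∈H y₁∈H y₂∈H y₃∈H y₁≢y₂ y₁≢y₃ y₂≢y₃ y₁→x y₂→x y₃→x =
    no-three-hole-neighbours x∈H y₁∈H y₂∈H y₃∈H
      (≢-sym (arc⇒≢ acyclic y₁→x)) (≢-sym (arc⇒≢ acyclic y₂→x)) (≢-sym (arc⇒≢ acyclic y₃→x))
      y₁≢y₂ y₁≢y₃ y₂≢y₃ (inj₂ y₁→x) (inj₂ y₂→x) (inj₂ y₃→x)

  indegH≤2 : ∀ a → indegH D l h a ≤ 2
  indegH≤2 a = countFin≤ at-most-two
    where
    at-most-two : ∀ {bs} → Unique bs → All (λ b → Arc D (h b) (h a)) bs → length bs ≤ 2
    at-most-two {[]} _ _ = z≤n
    at-most-two {_ ∷ []} _ _ = s≤s z≤n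
    at-most-two {_ ∷ _ ∷ []} _ _ = s≤s (s≤s z≤n)
    at-most-two {b₁ ∷ b₂ ∷ b₃ ∷ _} ((b₁≢b₂ ∷ b₁≢b₃ ∷ _) ∷ (b₂≢b₃ ∷ _) ∷ _) (b₁→a ∷ b₂→a ∷ b₃→a ∷ _) =
      ⊥-elim (no-three-hole-in-neighbours (a , refl) (b₁ , refl) (b₂ , refl) (b₃ , refl)
                (h-≢ b₁≢b₂) (h-≢ b₁≢b₃) (h-≢ b₂≢b₃) b₁→a b₂→a b₃→a)

  InC : Fin n → Set
  InC = InVC D l h

  InC⇒OnHole : ∀ {x} → InC x → OnHole x
  InC⇒OnHole (a , ha≡x , _) = a , ha≡x

  hole-in-neighbour-unique : ∀ {x y₁ y₂} → InC x → OnHole y₁ → OnHole y₂ →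
    Arc D y₁ x → Arc D y₂ x → y₁ ≡ y₂
  hole-in-neighbour-unique (a , refl , a∉Γ) (b₁ , refl) (b₂ , refl) b₁→a b₂→a with b₁ ≟ b₂
  ... | yes refl = refl
  ... | no b₁≢b₂ = ⊥-elim (a∉Γ (≤-antisym (indegH≤2 a)
                     (length≤countFin ((b₁≢b₂ ∷ []) ∷ [] ∷ []) (b₁→a ∷ b₂→a ∷ []))))

  hole-out-neighbour : ∀ {x} → InC x → ∃ λ t → OnHole t × Arc D x t
  hole-out-neighbour x∈C@(a , refl , _) with two-CycConsec 3≤l a
  ... | b , c , a≢b , a≢c , b≢c , a~b , a~c
    with consecutive⇒adjacent a≢b a~b | consecutive⇒adjacent a≢c a~c
  ... | inj₁ a→b | _        = h b , (b , refl) , a→b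
  ... | inj₂ _   | inj₁ a→c = h c , (c , refl) , a→c
  ... | inj₂ b→a | inj₂ c→a = ⊥-elim (h-≢ b≢c (hole-in-neighbour-unique x∈C (b , refl) (c , refl) b→a c→a))

  OffOut : Fin n → Fin n → Set
  OffOut x w = Arc D x w × ¬ OnHole w

  on≢off : ∀ {t w} → OnHole t → ¬ OnHole w → t ≢ w
  on≢off t∈H w∉H refl = w∉H t∈H

  off-out-unique : ∀ {x w w′} → InC x → OffOut x w → OffOut x w′ → w ≡ w′
  off-out-unique {w = w} {w′} x∈C (x→w , w∉H) (x→w′ , w′∉H) with w ≟ w′ | hole-out-neighbour x∈C
  ... | yes w≡w′ | _ = w≡w′
  ... | no w≢w′  | t , t∈H , x→t =
    ⊥-elim (no-three-out-neighbours outdeg≤2 (on≢off t∈H w∉H) (on≢off t∈H w′∉H) w≢w′ x→t x→w x→w′)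

  hole-out-unique : ∀ {x t t′} → ∃ (OffOut x) → OnHole t → OnHole t′ → Arc D x t → Arc D x t′ → t ≡ t′
  hole-out-unique {t = t} {t′} (w , x→w , w∉H) t∈H t′∈H x→t x→t′ with t ≟ t′
  ... | yes t≡t′ = t≡t′
  ... | no t≢t′  =
    ⊥-elim (no-three-out-neighbours outdeg≤2 t≢t′ (on≢off t∈H w∉H) (on≢off t′∈H w∉H) x→t x→t′ x→w)

  AdjViaHole : Fin n → Fin n → Set
  AdjViaHole x y = Arc D x y ⊎ Arc D y x ⊎ ∃ λ t → OnHole t × Arc D x t × Arc D y t

  AdjViaHole-sym : ∀ {x y} → AdjViaHole x y → AdjViaHole y x
  AdjViaHole-sym (inj₁ x→y) = inj₂ (inj₁ x→y)
  AdjViaHole-sym (inj₂ (inj₁ y→x)) = inj₁ y→x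
  AdjViaHole-sym (inj₂ (inj₂ (t , t∈H , x→t , y→t))) = inj₂ (inj₂ (t , t∈H , y→t , x→t))

  PAdj⇒AdjViaHole⊎common-off : ∀ {x y} → PAdj D x y → AdjViaHole x y ⊎ ∃ λ w → OffOut x w × OffOut y w
  PAdj⇒AdjViaHole⊎common-off (_ , inj₁ x→y) = inj₁ (inj₁ x→y)
  PAdj⇒AdjViaHole⊎common-off (_ , inj₂ (inj₁ y→x)) = inj₁ (inj₂ (inj₁ y→x))
  PAdj⇒AdjViaHole⊎common-off (_ , inj₂ (inj₂ (w , x→w , y→w))) with on-hole? w
  ... | yes w∈H = inj₁ (inj₂ (inj₂ (w , w∈H , x→w , y→w)))
  ... | no  w∉H = inj₂ (w , (x→w , w∉H) , (y→w , w∉H))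

  Reaches : Fin n → Fin n → Fin n → Set
  Reaches x y t = Arc D x t × OnHole t × (t ≡ y ⊎ Arc D y t)

  AdjViaHole⇒in⊎reaches : ∀ {x y} → InC y → AdjViaHole x y → Arc D y x ⊎ ∃ (Reaches x y)
  AdjViaHole⇒in⊎reaches y∈C (inj₁ x→y) = inj₂ (_ , x→y , InC⇒OnHole y∈C , inj₁ refl)
  AdjViaHole⇒in⊎reaches _ (inj₂ (inj₁ y→x)) = inj₁ y→x
  AdjViaHole⇒in⊎reaches _ (inj₂ (inj₂ (t , t∈H , x→t , y→t))) = inj₂ (t , x→t , t∈H , inj₂ y→t)

  AdjViaHole⇒reaches : ∀ {x y} → InC x → InC y → AdjViaHole x y → ∃ (Reaches x y) ⊎ ∃ (Reaches y x)
  AdjViaHole⇒reaches x∈C y∈C x~y with AdjViaHole⇒in⊎reaches y∈C x~y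
  ... | inj₁ y→x = inj₂ (_ , y→x , InC⇒OnHole x∈C , inj₁ refl)
  ... | inj₂ x⇝y = inj₁ x⇝y

  reaches-same-target : ∀ {x y z t} → InC x → InC y → InC z → x ≢ y → x ≢ z → y ≢ z →
    Reaches x y t → Reaches x z t → ⊥
  reaches-same-target _ _ _ _ _ y≢z (_ , _ , inj₁ refl) (_ , _ , inj₁ refl) = y≢z refl
  reaches-same-target x∈C y∈C z∈C _ x≢z _ (x→y , _ , inj₁ refl) (_ , _ , inj₂ z→y) =
    x≢z (hole-in-neighbour-unique y∈C (InC⇒OnHole x∈C) (InC⇒OnHole z∈C) x→y z→y)
  reaches-same-target x∈C y∈C z∈C x≢y _ _ (_ , _ , inj₂ y→z) (x→z , _ , inj₁ refl) =
    x≢y (hole-in-neighbour-unique z∈C (InC⇒OnHole x∈C) (InC⇒OnHole y∈C) x→z y→z)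
  reaches-same-target x∈C y∈C z∈C x≢y x≢z y≢z (x→t , t∈H , inj₂ y→t) (_ , _ , inj₂ z→t) =
    no-three-hole-in-neighbours t∈H (InC⇒OnHole x∈C) (InC⇒OnHole y∈C) (InC⇒OnHole z∈C)
      x≢y x≢z y≢z x→t y→t z→t

  reaches-unique : ∀ {x y z t t′} → ∃ (OffOut x) → InC x → InC y → InC z → x ≢ y → x ≢ z → y ≢ z →
    Reaches x y t → Reaches x z t′ → ⊥
  reaches-unique x-off x∈C y∈C z∈C x≢y x≢z y≢z x⇝y@(x→t , t∈H , _) x⇝z@(x→t′ , t′∈H , _)
    with refl ← hole-out-unique x-off t∈H t′∈H x→t x→t′ =
    reaches-same-target x∈C y∈C z∈C x≢y x≢z y≢z x⇝y x⇝z

  two-reaches-and-third : ∀ {x y z u t t′} → InC x → InC y → InC z → InC u →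
    x ≢ y → x ≢ z → x ≢ u → y ≢ z → y ≢ u → z ≢ u →
    Reaches x y t → Reaches x z t′ → Arc D u x ⊎ ∃ (Reaches x u) → ⊥
  two-reaches-and-third {t = t} {t′} x∈C y∈C z∈C u∈C x≢y x≢z x≢u y≢z y≢u z≢u
    x⇝y@(x→t , t∈H , _) x⇝z@(x→t′ , t′∈H , _) third with t ≟ t′ | third
  ... | yes refl | _ = reaches-same-target x∈C y∈C z∈C x≢y x≢z y≢z x⇝y x⇝z
  ... | no t≢t′  | inj₁ u→x =
    no-three-hole-neighbours (InC⇒OnHole x∈C) t∈H t′∈H (InC⇒OnHole u∈C)
      (arc⇒≢ acyclic x→t) (arc⇒≢ acyclic x→t′) x≢u t≢t′
      (λ { refl → no-2-cycle acyclic x→t u→x }) (λ { refl → no-2-cycle acyclic x→t′ u→x })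
      (inj₁ x→t) (inj₁ x→t′) (inj₂ u→x)
  ... | no t≢t′  | inj₂ (t″ , x⇝u@(x→t″ , _)) with t″ ≟ t | t″ ≟ t′
  ...   | yes refl | _        = reaches-same-target x∈C y∈C u∈C x≢y x≢u y≢u x⇝y x⇝u
  ...   | no _     | yes refl = reaches-same-target x∈C z∈C u∈C x≢z x≢u z≢u x⇝z x⇝u
  ...   | no t″≢t  | no t″≢t′ =
    no-three-out-neighbours outdeg≤2 t≢t′ (≢-sym t″≢t) (≢-sym t″≢t′) x→t x→t′ x→t″

  no-three-AdjViaHole : ∀ {x y₁ y₂ y₃} → InC x → InC y₁ → InC y₂ → InC y₃ →
    x ≢ y₁ → x ≢ y₂ → x ≢ y₃ → y₁ ≢ y₂ → y₁ ≢ y₃ → y₂ ≢ y₃ →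
    AdjViaHole x y₁ → AdjViaHole x y₂ → AdjViaHole x y₃ → ⊥
  no-three-AdjViaHole x∈C y₁∈C y₂∈C y₃∈C x≢y₁ x≢y₂ x≢y₃ y₁≢y₂ y₁≢y₃ y₂≢y₃ x~y₁ x~y₂ x~y₃
    with AdjViaHole⇒in⊎reaches y₁∈C x~y₁ | AdjViaHole⇒in⊎reaches y₂∈C x~y₂
       | AdjViaHole⇒in⊎reaches y₃∈C x~y₃
  ... | inj₁ y₁→x | inj₁ y₂→x | _ =
    y₁≢y₂ (hole-in-neighbour-unique x∈C (InC⇒OnHole y₁∈C) (InC⇒OnHole y₂∈C) y₁→x y₂→x)
  ... | inj₁ y₁→x | inj₂ _ | inj₁ y₃→x =
    y₁≢y₃ (hole-in-neighbour-unique x∈C (InC⇒OnHole y₁∈C) (InC⇒OnHole y₃∈C) y₁→x y₃→x)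
  ... | inj₂ _ | inj₁ y₂→x | inj₁ y₃→x =
    y₂≢y₃ (hole-in-neighbour-unique x∈C (InC⇒OnHole y₂∈C) (InC⇒OnHole y₃∈C) y₂→x y₃→x)
  ... | inj₂ (_ , x⇝y₁) | inj₂ (_ , x⇝y₂) | third =
    two-reaches-and-third x∈C y₁∈C y₂∈C y₃∈C x≢y₁ x≢y₂ x≢y₃ y₁≢y₂ y₁≢y₃ y₂≢y₃ x⇝y₁ x⇝y₂ third
  ... | inj₂ (_ , x⇝y₁) | inj₁ y₂→x | inj₂ (_ , x⇝y₃) =
    two-reaches-and-third x∈C y₁∈C y₃∈C y₂∈C x≢y₁ x≢y₃ x≢y₂ y₁≢y₃ y₁≢y₂ (≢-sym y₂≢y₃) x⇝y₁ x⇝y₃ (inj₁ y₂→x)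
  ... | inj₁ y₁→x | inj₂ (_ , x⇝y₂) | inj₂ (_ , x⇝y₃) =
    two-reaches-and-third x∈C y₂∈C y₃∈C y₁∈C x≢y₂ x≢y₃ x≢y₁ y₂≢y₃ (≢-sym y₁≢y₂) (≢-sym y₁≢y₃)
      x⇝y₂ x⇝y₃ (inj₁ y₁→x)

  -- If x reaches y through a common out-neighbour t, then t is also the one through which y reaches z,
  -- so x would reach z as well.
  reaches-chain⇒arc : ∀ {x y z t} → ∃ (OffOut y) → InC x → InC y → InC z → x ≢ y → x ≢ z → y ≢ z →
    Reaches x y t → ∃ (Reaches y z) → Arc D x y
  reaches-chain⇒arc _ _ _ _ _ _ _ (x→y , _ , inj₁ refl) _ = x→y
  reaches-chain⇒arc y-off x∈C y∈C z∈C x≢y x≢z y≢z (x→t , t∈H , inj₂ y→t) (_ , y→t′ , t′∈H , z-at-t′)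
    with refl ← hole-out-unique y-off t∈H t′∈H y→t y→t′ =
    ⊥-elim (reaches-same-target x∈C y∈C z∈C x≢y x≢z y≢z (x→t , t∈H , inj₂ y→t) (x→t , t∈H , z-at-t′))

  reaches-forced : ∀ {x y z} → ∃ (OffOut x) → InC x → InC y → InC z → x ≢ y → x ≢ z → y ≢ z →
    ∃ (Reaches x y) → AdjViaHole z x → ∃ (Reaches z x)
  reaches-forced x-off x∈C y∈C z∈C x≢y x≢z y≢z (_ , x⇝y) z~x with AdjViaHole⇒reaches z∈C x∈C z~x
  ... | inj₁ z⇝x = z⇝x
  ... | inj₂ (_ , x⇝z) = ⊥-elim (reaches-unique x-off x∈C y∈C z∈C x≢y x≢z y≢z x⇝y x⇝z)

  no-reaches-square : ∀ {a b c d} → InC a → InC b → InC c → InC d →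
    a ≢ b → a ≢ c → a ≢ d → b ≢ c → b ≢ d → c ≢ d →
    ∃ (OffOut a) → ∃ (OffOut b) → ∃ (OffOut c) → ∃ (OffOut d) →
    ∃ (Reaches a b) → ∃ (Reaches b c) → ∃ (Reaches c d) → ∃ (Reaches d a) → ⊥
  no-reaches-square a∈C b∈C c∈C d∈C a≢b a≢c a≢d b≢c b≢d c≢d a-off b-off c-off d-off
    (_ , a⇝b) (_ , b⇝c) (_ , c⇝d) (_ , d⇝a) =
    no-4-cycle acyclic
      (reaches-chain⇒arc b-off a∈C b∈C c∈C a≢b a≢c b≢c a⇝b (_ , b⇝c))
      (reaches-chain⇒arc c-off b∈C c∈C d∈C b≢c b≢d c≢d b⇝c (_ , c⇝d))
      (reaches-chain⇒arc d-off c∈C d∈C a∈C c≢d (≢-sym a≢c) (≢-sym a≢d) c⇝d (_ , d⇝a))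
      (reaches-chain⇒arc a-off d∈C a∈C b∈C (≢-sym a≢d) (≢-sym b≢d) a≢b d⇝a (_ , a⇝b))

  no-AdjViaHole-square : ∀ {a b c d} → InC a → InC b → InC c → InC d →
    a ≢ b → a ≢ c → a ≢ d → b ≢ c → b ≢ d → c ≢ d →
    ∃ (OffOut a) → ∃ (OffOut b) → ∃ (OffOut c) → ∃ (OffOut d) →
    AdjViaHole a b → AdjViaHole b c → AdjViaHole c d → AdjViaHole d a → ⊥
  no-AdjViaHole-square a∈C b∈C c∈C d∈C a≢b a≢c a≢d b≢c b≢d c≢d a-off b-off c-off d-off a~b b~c c~d d~a
    with AdjViaHole⇒reaches a∈C b∈C a~b
  ... | inj₁ a⇝b =
    let d⇝a = reaches-forced a-off a∈C b∈C d∈C a≢b a≢d b≢d a⇝b d~a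
        c⇝d = reaches-forced d-off d∈C a∈C c∈C (≢-sym a≢d) (≢-sym c≢d) a≢c d⇝a c~d
        b⇝c = reaches-forced c-off c∈C d∈C b∈C c≢d (≢-sym b≢c) (≢-sym b≢d) c⇝d b~c
    in no-reaches-square a∈C b∈C c∈C d∈C a≢b a≢c a≢d b≢c b≢d c≢d a-off b-off c-off d-off a⇝b b⇝c c⇝d d⇝a
  ... | inj₂ b⇝a =
    let c⇝b = reaches-forced b-off b∈C a∈C c∈C (≢-sym a≢b) b≢c a≢c b⇝a (AdjViaHole-sym b~c)
        d⇝c = reaches-forced c-off c∈C b∈C d∈C (≢-sym b≢c) c≢d b≢d c⇝b (AdjViaHole-sym c~d)
        a⇝d = reaches-forced d-off d∈C c∈C a∈C (≢-sym c≢d) (≢-sym a≢d) (≢-sym a≢c) d⇝c (AdjViaHole-sym d~a)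
    in no-reaches-square a∈C d∈C c∈C b∈C a≢d a≢c a≢b (≢-sym c≢d) (≢-sym b≢d) (≢-sym b≢c)
         a-off d-off c-off b-off a⇝d d⇝c c⇝b b⇝a

  module _ {K : List (Fin n)} (K⊆C : All InC K)
           (clique : ∀ x y → x ∈ K → y ∈ K → x ≢ y → PAdj D x y) where

    open CommonTarget _≟_ (_∈ K) AdjViaHole OffOut

    private
      inC : ∀ {x} → x ∈ K → InC x
      inC = All.lookup K⊆C

    clique-small-or-common-off-out : Unique K → length K ≤ 3 ⊎ ∃ λ w → All (λ x → OffOut x w) K
    clique-small-or-common-off-out K! =
      small-or-common-target
        AdjViaHole-sym
        (λ x∈K → off-out-unique (inC x∈K))
        (λ {x} {y} x∈K y∈K x≢y → PAdj⇒AdjViaHole⊎common-off (clique x y x∈K y∈K x≢y))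
        (λ x∈K y₁∈K y₂∈K y₃∈K → no-three-AdjViaHole (inC x∈K) (inC y₁∈K) (inC y₂∈K) (inC y₃∈K))
        (λ a∈K b∈K c∈K d∈K → no-AdjViaHole-square (inC a∈K) (inC b∈K) (inC c∈K) (inC d∈K))
        K! (All.tabulate (λ x∈K → x∈K))

lemma2p7 : (i : ℕ) → 3 ≤ i → (n : ℕ) → (D : Digraph n) → IsIJDigraph i 2 D
    → (l : ℕ) → 5 ≤ l → (h : Fin l → Fin n) → IsHole D l h
    → (K : List (Fin n)) → Unique K → All (InVC D l h) K
    → (∀ x y → x ∈ K → y ∈ K → x ≢ y → PAdj D x y)
    → length K ≤ i
lemma2p7 i 3≤i n D (acyclic , indeg≤i , outdeg≤2) l _ h hole K K! K⊆C clique
  with Hole.clique-small-or-common-off-out acyclic outdeg≤2 hole K⊆C clique K!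
... | inj₁ |K|≤3 = ≤-trans |K|≤3 3≤i
... | inj₂ (w , K→w) = ≤-trans (length≤countFin K! (All.map proj₁ K→w)) (indeg≤i w)
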